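{- Let $m,n,r$ be positive integers with $0<m<n$ and $\gcd(m,n)=1$, and let $p$ be a prime. Then $v_p(D_{m,n,r})$ is at most the number of positive integers $i$ for which there exists a positive integer $l_i$ with $\gcd(l_i,n)=1$ and $l_i p^i \equiv -m \pmod n$ such that \[ \frac{l_i p^i + m}{n} \leq (r \bmod p^i) \leq \frac{(n-l_i)p^i - m - n}{n}. \] Furthermore, all such $i$ satisfy $p^i \leq nr$.
   Context: For positive integers $m,n,r$ with $\gcd(m,n)=1$, $Y_{m,n,r}(z) = {}_2F_1(-r,-r-m/n;1-m/n;z)$, a polynomial in $\mathbb{Q}[z]$, where ${}_2F_1(\alpha,\beta;\gamma;z) = 1 + \sum_{k\ge1} \frac{\alpha(\alpha+1)\cdots(\alpha+k-1)\,\beta(\beta+1)\cdots(\beta+k-1)}{\gamma(\gamma+1)\cdots(\gamma+k-1)\,k!} z^k$. $D_{m,n,r}$ is the smallest positive integer such that $D_{m,n,r}Y_{m,n,r}(z)$ has rational integer coefficients. $v_p(x)$ is the exponent of $p$ in $x$. $r \bmod p^i$ denotes the least non-negative residue of $r$ modulo $p^i$. -}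

module Defs where

open import Data.Nat as ℕ using (ℕ; zero; suc; _+_; _*_; _∸_; _^_; _≤_; _<_)
open import Data.Nat.DivMod using (_%_)
open import Data.Nat.Divisibility using (_∣?_; divides; _∣_)
open import Data.Nat.GCD using (gcd)
open import Relation.Binary.PropositionalEquality using (_≡_)
open import Data.Integer as ℤ using (ℤ; +_)
import Data.Integer.Divisibility as ℤD
open import Data.Product using (_×_; Σ)
open import Relation.Nullary using (yes; no)

-- Coefficients of Y_{m,n,r}(z) = 2F1(-r, -r-m/n; 1-m/n; z).
-- The k-th coefficient is  prod_{j<k} (-r+j)(-r-m/n+j) / ((1-m/n+j)(1+j)).
-- Multiplying each of the factors (-r-m/n+j) and (1-m/n+j) by n, this equals
--   coeffNum m n r k / coeffDen m n r k  with
--   coeffNum = prod_{j<k} (j - r) * (n j - n r - m)          (an integer)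
--   coeffDen = prod_{j<k} (n - m + n j) * (j + 1)            (a positive natural when m < n)

prodℤ : (ℕ → ℤ) → ℕ → ℤ
prodℤ f zero    = + 1
prodℤ f (suc k) = prodℤ f k ℤ.* f k

prodℕ : (ℕ → ℕ) → ℕ → ℕ
prodℕ f zero    = 1
prodℕ f (suc k) = prodℕ f k * f k

coeffNum : ℕ → ℕ → ℕ → ℕ → ℤ
coeffNum m n r k =
  prodℤ (λ j → (+ j ℤ.- + r) ℤ.* (+ (n * j) ℤ.- + (n * r) ℤ.- + m)) k

coeffDen : ℕ → ℕ → ℕ → ℕ → ℕ
coeffDen m n r k = prodℕ (λ j → (n ∸ m + n * j) * suc j) k

ClearsDenominators : ℕ → ℕ → ℕ → ℕ → Set
ClearsDenominators m n r D =
  ∀ k → (+ coeffDen m n r k) ℤD.∣ (+ D ℤ.* coeffNum m n r k)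

IsD : ℕ → ℕ → ℕ → ℕ → Set
IsD m n r D =
  (0 < D) × ClearsDenominators m n r D ×
  (∀ D' → 0 < D' → ClearsDenominators m n r D' → D ≤ D')

-- p-adic valuation (with fuel; fuel = x suffices for p ≥ 2, x ≥ 1).  v_p(0) := 0.
vAux : ℕ → ℕ → ℕ → ℕ
vAux zero    p x = 0
vAux (suc f) p zero = 0
vAux (suc f) p (suc x) with p ∣? suc x
... | yes (divides q _) = suc (vAux f p q)
... | no _ = 0

v : ℕ → ℕ → ℕ
v p x = vAux x p x

-- least non-negative residue of r modulo q (q > 0 in all uses)
_mod_ : ℕ → ℕ → ℕ
r mod zero    = r
r mod (suc q) = r % suc q

-- The condition on i from Proposition 3.2: there is a positive integer l with
-- gcd(l,n)=1, l p^i ≡ -m (mod n), and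
--   (l p^i + m)/n ≤ (r mod p^i) ≤ ((n-l) p^i - m - n)/n,
-- the two inequalities being stated after multiplying through by n > 0 (in ℤ).
Cond : ℕ → ℕ → ℕ → ℕ → ℕ → Set
Cond m n r p i =
  Σ ℕ λ l → (0 < l) × (gcd l n ≡ 1) × (n ∣ l * p ^ i + m)
    × (+ (l * p ^ i + m) ℤ.≤ + (n * (r mod (p ^ i))))
    × (+ (n * (r mod (p ^ i))) ℤ.≤ (+ n ℤ.- + l) ℤ.* + (p ^ i) ℤ.- + m ℤ.- + n)

{-# OPTIONS --safe #-}
module Submission where

-- Write the k-th coefficient (k ≤ r) of Y_{m,n,r} as ± N_k / D_k with
--   N_k = ∏_{j<k} (r - j) (n (r - j) + m)  and  D_k = ∏_{j<k} (n - m + n j) (j + 1).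
-- Counting, for each i ≥ 1, the factors divisible by q = p^i gives
--   v_p(D_k) - v_p(N_k) = ∑_i (#{denominator factors divisible by q} - #{numerator factors divisible by q}).
-- If p ∣ n, no factor n - m + n j is divisible by q.  Otherwise pick t ∈ [1, q] with n t ≡ m (mod q);
-- the four families of factors then become, up to divisibility by q, the integers in the intervals
-- (0, k], (q - t, q - t + k], (r - k, r] and (r - k + t, r + t].  Comparing the multiples of q in
-- them, the i-th summand is at most 1, and it is positive only if t ≤ r mod q < q - t, which is the
-- condition of the statement for l = (n t - m) / q.  All valuations involved are at most n r, so
-- v_p(D_k) ≤ v_p(N_k) + e where e counts these i up to n r; if v_p(D) > e then D / p would still
-- clear every denominator, contradicting the minimality of D.

open import Defs
open import Data.Nat using (ℕ; _*_; _^_; _≤_; _<_)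
open import Data.Nat.GCD using (gcd)
open import Data.Nat.Primality using (Prime)
open import Data.List using (List; length)
open import Data.List.Relation.Unary.All using (All)
open import Data.List.Relation.Unary.Unique.Propositional using (Unique)
open import Data.Product using (_×_; ∃)
open import Relation.Binary.PropositionalEquality using (_≡_)

open import Data.Empty using (⊥-elim)
open import Data.Integer as ℤ using (ℤ)
import Data.Integer.Properties as ℤ
import Data.Integer.Tactic.RingSolver as ℤ-Solver
open import Data.List using ([]; _∷_; map; filter; downFrom)
open import Data.List.Properties using (length-map)
import Data.List.Relation.Unary.All as All
open import Data.List.Relation.Unary.All.Properties using (all-filter) renaming (map⁺ to All-map⁺)
import Data.List.Relation.Unary.Unique.Propositional.Properties as Unique
open import Data.Nat
open import Data.Nat.Coprimality using (Coprime; coprime-divisor; coprime-Bézout; coprime⇒gcd≡1)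
import Data.Nat.Coprimality as Coprime
open import Data.Nat.Divisibility
open import Data.Nat.DivMod using (_%_; _/_; m≡m%n+[m/n]*n; m%n<n; m%n≤m; m<n⇒m%n≡m; %-distribˡ-+)
open import Data.Nat.GCD using (module Bézout; gcd-greatest)
open import Data.Nat.Primality using (euclidsLemma; prime⇒irreducible; prime⇒nonTrivial; prime⇒nonZero)
open import Data.Nat.Properties
open import Algebra.Properties.CommutativeSemigroup +-commutativeSemigroup
  using (x∙yz≈xz∙y) renaming (interchange to +-interchange; xy∙z≈xz∙y to m+n+o≡m+o+n)
open import Algebra.Properties.CommutativeSemigroup *-commutativeSemigroup
  using () renaming (interchange to *-interchange)
open import Data.Nat.Tactic.RingSolver using (solve; solve-∀)
open import Data.Product using (_,_; ∃-syntax)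
open import Data.Sum using (_⊎_; inj₁; inj₂)
open import Function.Base using (_∘_)
open import Function.Bundles using (_⇔_; mk⇔; Equivalence)
open import Relation.Binary.PropositionalEquality
  using (refl; sym; trans; cong; cong₂; subst; subst₂; module ≡-Reasoning)
open import Relation.Nullary using (Dec; yes; no; ¬_)
open import Relation.Nullary.Decidable using (_×-dec_)
open import Relation.Unary using (Pred; Decidable)

χ : ∀ {A : Set} → Dec A → ℕ
χ (yes _) = 1
χ (no _)  = 0

χ-mono : ∀ {A B : Set} (a? : Dec A) (b? : Dec B) → (A → B) → χ a? ≤ χ b?
χ-mono (yes a) (yes _) _ = ≤-refl
χ-mono (yes a) (no ¬b) f = ⊥-elim (¬b (f a))
χ-mono (no _)  _       _ = z≤n

χ-cong : ∀ {A B : Set} (a? : Dec A) (b? : Dec B) → (A → B) → (B → A) → χ a? ≡ χ b?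
χ-cong a? b? f g = ≤-antisym (χ-mono a? b? f) (χ-mono b? a? g)

χ-yes : ∀ {A : Set} (a? : Dec A) → A → χ a? ≡ 1
χ-yes (yes _) _ = refl
χ-yes (no ¬a) a = ⊥-elim (¬a a)

χ-no : ∀ {A : Set} (a? : Dec A) → ¬ A → χ a? ≡ 0
χ-no (yes a) ¬a = ⊥-elim (¬a a)
χ-no (no _)  _  = refl

∑< : ℕ → (ℕ → ℕ) → ℕ
∑< zero    f = 0
∑< (suc k) f = ∑< k f + f k

infix 10 ∑<
syntax ∑< k (λ j → e) = ∑[ j < k ] e

module _ (f g : ℕ → ℕ) where

  ∑-cong : ∀ k → (∀ {j} → j < k → f j ≡ g j) → ∑< k f ≡ ∑< k g
  ∑-cong zero    _  = refl
  ∑-cong (suc k) eq = cong₂ _+_ (∑-cong k (eq ∘ m<n⇒m<1+n)) (eq ≤-refl)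

  ∑-mono-≤ : ∀ k → (∀ {j} → j < k → f j ≤ g j) → ∑< k f ≤ ∑< k g
  ∑-mono-≤ zero    _  = z≤n
  ∑-mono-≤ (suc k) le = +-mono-≤ (∑-mono-≤ k (le ∘ m<n⇒m<1+n)) (le ≤-refl)

  ∑-distrib-+ : ∀ k → ∑[ j < k ] (f j + g j) ≡ ∑< k f + ∑< k g
  ∑-distrib-+ zero    = refl
  ∑-distrib-+ (suc k) = begin
    ∑[ j < k ] (f j + g j) + (f k + g k) ≡⟨ cong (_+ (f k + g k)) (∑-distrib-+ k) ⟩
    ∑< k f + ∑< k g + (f k + g k)        ≡⟨ +-interchange (∑< k f) (∑< k g) (f k) (g k) ⟩
    ∑< k f + f k + (∑< k g + g k)        ∎
    where open ≡-Reasoning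

∑≡0 : ∀ (f : ℕ → ℕ) k → (∀ {j} → j < k → f j ≡ 0) → ∑< k f ≡ 0
∑≡0 f k eq = trans (∑-cong f (λ _ → 0) k eq) (∑0 k)
  where
  ∑0 : ∀ k → ∑[ j < k ] 0 ≡ 0
  ∑0 zero    = refl
  ∑0 (suc k) = trans (+-identityʳ _) (∑0 k)

∑-comm : ∀ (f : ℕ → ℕ → ℕ) k l → ∑[ j < k ] ∑[ i < l ] f j i ≡ ∑[ i < l ] ∑[ j < k ] f j i
∑-comm f zero    l = sym (∑≡0 (λ _ → 0) l (λ _ → refl))
∑-comm f (suc k) l = trans (cong (_+ ∑< l (f k)) (∑-comm f k l))
                           (sym (∑-distrib-+ (λ i → ∑[ j < k ] f j i) (f k) l))

∑-split : ∀ (f : ℕ → ℕ) a b → ∑< (a + b) f ≡ ∑< a f + ∑[ j < b ] f (a + j)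
∑-split f a zero    = trans (cong (λ c → ∑< c f) (+-identityʳ a)) (sym (+-identityʳ _))
∑-split f a (suc b) = begin
  ∑< (a + suc b) f                                 ≡⟨ cong (λ c → ∑< c f) (+-suc a b) ⟩
  ∑< (a + b) f + f (a + b)                         ≡⟨ cong (_+ f (a + b)) (∑-split f a b) ⟩
  ∑< a f + ∑[ j < b ] f (a + j) + f (a + b)        ≡⟨ +-assoc (∑< a f) _ _ ⟩
  ∑< a f + (∑[ j < b ] f (a + j) + f (a + b))      ∎
  where open ≡-Reasoning

∑-reverse : ∀ (f : ℕ → ℕ) k → ∑< k f ≡ ∑[ j < k ] f (k ∸ suc j)
∑-reverse f zero    = refl
∑-reverse f (suc k) = begin
  ∑< k f + f k                                 ≡⟨ cong (_+ f k) (∑-reverse f k) ⟩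
  ∑[ j < k ] f (k ∸ suc j) + f k               ≡⟨ +-comm _ (f k) ⟩
  f k + ∑[ j < k ] f (k ∸ suc j)               ≡⟨ sym (∑-split (λ j → f (suc k ∸ suc j)) 1 k) ⟩
  ∑[ j < suc k ] f (suc k ∸ suc j)             ∎
  where open ≡-Reasoning

f≤∑ : ∀ (f : ℕ → ℕ) {j k} → j < k → f j ≤ ∑< k f
f≤∑ f {j} {suc k} j<1+k with m<1+n⇒m<n∨m≡n j<1+k
... | inj₁ j<k  = ≤-trans (f≤∑ f j<k) (m≤m+n _ _)
... | inj₂ refl = m≤n+m _ _

1≤+ : ∀ a b c → 1 ≤ a ⊎ 1 ≤ b ⊎ 1 ≤ c → 1 ≤ a + b + c
1≤+ a b c (inj₁ 1≤a)        = ≤-trans 1≤a (≤-trans (m≤m+n a b) (m≤m+n (a + b) c))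
1≤+ a b c (inj₂ (inj₁ 1≤b)) = ≤-trans 1≤b (≤-trans (m≤n+m b a) (m≤m+n (a + b) c))
1≤+ a b c (inj₂ (inj₂ 1≤c)) = ≤-trans 1≤c (m≤n+m c (a + b))

prodℕ-pos : ∀ (f : ℕ → ℕ) k → (∀ {j} → j < k → 1 ≤ f j) → 1 ≤ prodℕ f k
prodℕ-pos f zero    _   = ≤-refl
prodℕ-pos f (suc k) pos = *-mono-≤ (prodℕ-pos f k (pos ∘ m<n⇒m<1+n)) (pos ≤-refl)

-- Multiples of q in an interval

∣-shift : ∀ {q a b x y} → q ∣ a → q ∣ b → x + a ≡ y + b → q ∣ x → q ∣ y
∣-shift {q} {b = b} {y = y} q∣a q∣b x+a≡y+b q∣x =
  ∣m+n∣m⇒∣n (subst (q ∣_) (trans x+a≡y+b (+-comm y b)) (∣m∣n⇒∣m+n q∣x q∣a)) q∣b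

countDivisible : ℕ → (ℕ → ℕ) → ℕ → ℕ
countDivisible q f k = ∑[ j < k ] χ (q ∣? f j)

countDivisible-cong : ∀ q (f g : ℕ → ℕ) k → (∀ {j} → j < k → q ∣ f j ⇔ q ∣ g j) →
                      countDivisible q f k ≡ countDivisible q g k
countDivisible-cong q f g k f⇔g =
  ∑-cong _ _ k (λ j<k → χ-cong _ _ (Equivalence.to (f⇔g j<k)) (Equivalence.from (f⇔g j<k)))

countDivisible-reverse : ∀ q (f : ℕ → ℕ) {k r} → k ≤ r →
  countDivisible q (λ j → f (r ∸ j)) k ≡ countDivisible q (λ j → f (suc (r ∸ k + j))) k
countDivisible-reverse q f {k} {r} k≤r =
  trans (∑-reverse _ k) (∑-cong _ _ k (λ j<k → cong (λ y → χ (q ∣? f y)) (r∸[k∸1+j] j<k)))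
  where
  r∸[k∸1+j] : ∀ {j} → j < k → r ∸ (k ∸ suc j) ≡ suc (r ∸ k + j)
  r∸[k∸1+j] {j} j<k = begin
    r ∸ (k ∸ suc j)                                 ≡⟨ cong (_∸ (k ∸ suc j)) r≡ ⟨
    suc (r ∸ k + j) + (k ∸ suc j) ∸ (k ∸ suc j)     ≡⟨ m+n∸n≡m _ (k ∸ suc j) ⟩
    suc (r ∸ k + j)                                 ∎
    where
    open ≡-Reasoning
    r≡ : suc (r ∸ k + j) + (k ∸ suc j) ≡ r
    r≡ = begin
      suc (r ∸ k + j) + (k ∸ suc j)   ≡⟨ cong (_+ (k ∸ suc j)) (+-suc (r ∸ k) j) ⟨
      r ∸ k + suc j + (k ∸ suc j)     ≡⟨ +-assoc (r ∸ k) (suc j) _ ⟩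
      r ∸ k + (suc j + (k ∸ suc j))   ≡⟨ cong (r ∸ k +_) (m+[n∸m]≡n j<k) ⟩
      r ∸ k + k                       ≡⟨ m∸n+n≡m k≤r ⟩
      r                               ∎

Window : ℕ → ℕ → ℕ → Set
Window q t ρ = t ≤ ρ × ρ + t < q

window? : ∀ q t ρ → Dec (Window q t ρ)
window? q t ρ = t ≤? ρ ×-dec ρ + t <? q

module _ (q : ℕ) .{{_ : NonZero q}} where

  multiplesIn : ℕ → ℕ → ℕ
  multiplesIn x k = countDivisible q (λ j → suc (x + j)) k

  multiplesIn-+ : ∀ x a b → multiplesIn x (a + b) ≡ multiplesIn x a + multiplesIn (x + a) b
  multiplesIn-+ x a b = trans (∑-split _ a b) (cong (multiplesIn x a +_)
    (∑-cong _ _ b (λ {j} _ → cong (λ y → χ (q ∣? suc y)) (sym (+-assoc x a j)))))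

  multiplesIn-+q : ∀ x k → multiplesIn (x + q) k ≡ multiplesIn x k
  multiplesIn-+q x k = countDivisible-cong q _ _ k λ {j} _ →
    mk⇔ (∣-shift (q ∣0) ∣-refl (sym (≡x+q+j j))) (∣-shift ∣-refl (q ∣0) (≡x+q+j j))
    where
    ≡x+q+j : ∀ j → suc (x + j) + q ≡ suc (x + q + j) + 0
    ≡x+q+j j = trans (cong suc (m+n+o≡m+o+n x j q)) (sym (+-identityʳ _))

  multiplesIn-+*q : ∀ x K k → multiplesIn (x + K * q) k ≡ multiplesIn x k
  multiplesIn-+*q x zero    k = cong (λ y → multiplesIn y k) (+-identityʳ x)
  multiplesIn-+*q x (suc K) k = begin
    multiplesIn (x + (q + K * q)) k  ≡⟨ cong (λ y → multiplesIn y k) (x∙yz≈xz∙y x q (K * q)) ⟩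
    multiplesIn (x + K * q + q) k    ≡⟨ multiplesIn-+q (x + K * q) k ⟩
    multiplesIn (x + K * q) k        ≡⟨ multiplesIn-+*q x K k ⟩
    multiplesIn x k                  ∎
    where open ≡-Reasoning

  multiplesIn≡0 : ∀ x κ → x + κ < q → multiplesIn x κ ≡ 0
  multiplesIn≡0 x κ x+κ<q = ∑≡0 _ κ (λ j<κ → χ-no _ (>⇒∤ (≤-trans (s≤s (+-monoʳ-< x j<κ)) x+κ<q)))

  multiplesIn≥1 : ∀ x κ → x < q → q ≤ x + κ → 1 ≤ multiplesIn x κ
  multiplesIn≥1 x κ x<q q≤x+κ =
    subst (_≤ multiplesIn x κ) (χ-yes _ (subst (q ∣_) (sym 1+x+j≡q) ∣-refl)) (f≤∑ _ j<κ)
    where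
    j = q ∸ suc x
    1+x+j≡q : suc (x + j) ≡ q
    1+x+j≡q = m+[n∸m]≡n x<q
    j<κ : j < κ
    j<κ = +-cancelˡ-< x j κ (subst (_≤ x + κ) (sym 1+x+j≡q) q≤x+κ)

  multiplesIn-slide : ∀ x → multiplesIn (suc x) q ≡ multiplesIn x q
  multiplesIn-slide x = +-cancelˡ-≡ (multiplesIn x 1) _ _ (begin
    multiplesIn x 1 + multiplesIn (suc x) q   ≡⟨ cong (λ y → multiplesIn x 1 + multiplesIn y q) (+-comm 1 x) ⟩
    multiplesIn x 1 + multiplesIn (x + 1) q   ≡⟨ multiplesIn-+ x 1 q ⟨
    multiplesIn x (1 + q)                     ≡⟨ cong (multiplesIn x) (+-comm 1 q) ⟩
    multiplesIn x (q + 1)                     ≡⟨ multiplesIn-+ x q 1 ⟩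
    multiplesIn x q + multiplesIn (x + q) 1   ≡⟨ cong (multiplesIn x q +_) (multiplesIn-+q x 1) ⟩
    multiplesIn x q + multiplesIn x 1         ≡⟨ +-comm (multiplesIn x q) _ ⟩
    multiplesIn x 1 + multiplesIn x q         ∎)
    where open ≡-Reasoning

  multiplesIn-period : ∀ x → multiplesIn x q ≡ 1
  multiplesIn-period zero    = begin
    multiplesIn 0 q                                ≡⟨ cong (multiplesIn 0) (suc-pred q) ⟨
    multiplesIn 0 (pred q) + χ (q ∣? suc (pred q)) ≡⟨ cong₂ _+_ (multiplesIn≡0 0 (pred q) (≤-reflexive (suc-pred q)))
                                                               (χ-yes _ (subst (q ∣_) (sym (suc-pred q)) ∣-refl)) ⟩
    1                                              ∎
    where open ≡-Reasoning
  multiplesIn-period (suc x) = trans (multiplesIn-slide x) (multiplesIn-period x)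

  multiplesIn-*q+ : ∀ x K κ → multiplesIn x (K * q + κ) ≡ K + multiplesIn x κ
  multiplesIn-*q+ x zero    κ = refl
  multiplesIn-*q+ x (suc K) κ = begin
    multiplesIn x (q + K * q + κ)                     ≡⟨ cong (multiplesIn x) (+-assoc q (K * q) κ) ⟩
    multiplesIn x (q + (K * q + κ))                   ≡⟨ multiplesIn-+ x q _ ⟩
    multiplesIn x q + multiplesIn (x + q) (K * q + κ) ≡⟨ cong₂ _+_ (multiplesIn-period x) (multiplesIn-+q x (K * q + κ)) ⟩
    1 + multiplesIn x (K * q + κ)                     ≡⟨ cong suc (multiplesIn-*q+ x K κ) ⟩
    suc K + multiplesIn x κ                           ∎
    where open ≡-Reasoning

  multiplesIn≤1 : ∀ x κ → κ ≤ q → multiplesIn x κ ≤ 1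
  multiplesIn≤1 x κ κ≤q = begin
    multiplesIn x κ                                     ≤⟨ m≤m+n _ _ ⟩
    multiplesIn x κ + multiplesIn (x + κ) (q ∸ κ)       ≡⟨ multiplesIn-+ x κ (q ∸ κ) ⟨
    multiplesIn x (κ + (q ∸ κ))                         ≡⟨ cong (multiplesIn x) (m+[n∸m]≡n κ≤q) ⟩
    multiplesIn x q                                     ≡⟨ multiplesIn-period x ⟩
    1                                                   ∎
    where open ≤-Reasoning

  multiplesIn-%+ : ∀ x t k → multiplesIn (x + t) k ≡ multiplesIn (x % q + t) k
  multiplesIn-%+ x t k = begin
    multiplesIn (x + t) k                      ≡⟨ cong (λ y → multiplesIn (y + t) k) (m≡m%n+[m/n]*n x q) ⟩
    multiplesIn (x % q + x / q * q + t) k      ≡⟨ cong (λ y → multiplesIn y k) (m+n+o≡m+o+n (x % q) _ t) ⟩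
    multiplesIn (x % q + t + x / q * q) k      ≡⟨ multiplesIn-+*q (x % q + t) (x / q) k ⟩
    multiplesIn (x % q + t) k                  ∎
    where open ≡-Reasoning

  multiplesIn-% : ∀ x k → multiplesIn x k ≡ multiplesIn (x % q) k
  multiplesIn-% x k = trans (cong (λ y → multiplesIn y k) (m≡m%n+[m/n]*n x q)) (multiplesIn-+*q (x % q) (x / q) k)

  multiplesIn-/% : ∀ x k → multiplesIn x k ≡ k / q + multiplesIn x (k % q)
  multiplesIn-/% x k = trans (cong (multiplesIn x) (trans (m≡m%n+[m/n]*n k q) (+-comm (k % q) _)))
                             (multiplesIn-*q+ x (k / q) (k % q))

  multiplesIn-0≤ : ∀ x k → multiplesIn 0 k ≤ multiplesIn x k
  multiplesIn-0≤ x k = begin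
    multiplesIn 0 k                   ≡⟨ multiplesIn-/% 0 k ⟩
    k / q + multiplesIn 0 (k % q)     ≡⟨ cong (k / q +_) (multiplesIn≡0 0 (k % q) (m%n<n k q)) ⟩
    k / q + 0                         ≤⟨ +-monoʳ-≤ (k / q) z≤n ⟩
    k / q + multiplesIn x (k % q)     ≡⟨ multiplesIn-/% x k ⟨
    multiplesIn x k                   ∎
    where open ≤-Reasoning

  private
    pair-rhs≥1 : ∀ {t} x κ → x < q → t ≤ κ →
      1 ≤ multiplesIn x κ + multiplesIn (x + t) κ + χ (window? q t ((x + κ) % q))
    pair-rhs≥1 {t} x κ x<q t≤κ = 1≤+ (multiplesIn x κ) (multiplesIn (x + t) κ) _ positive
      where
      positive : 1 ≤ multiplesIn x κ ⊎ 1 ≤ multiplesIn (x + t) κ ⊎ 1 ≤ χ (window? q t ((x + κ) % q))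
      positive with q ≤? x + κ | q ≤? x + t + κ
      ... | yes q≤x+κ | _           = inj₁ (multiplesIn≥1 x κ x<q q≤x+κ)
      ... | no q≰x+κ  | yes q≤x+t+κ = inj₂ (inj₁ (multiplesIn≥1 (x + t) κ x+t<q q≤x+t+κ))
        where
        x+t<q : x + t < q
        x+t<q = ≤-trans (s≤s (+-monoʳ-≤ x t≤κ)) (≰⇒> q≰x+κ)
      ... | no q≰x+κ  | no q≰x+t+κ  = inj₂ (inj₂ (≤-reflexive (sym (χ-yes (window? q t _) window))))
        where
        window : Window q t ((x + κ) % q)
        window = subst (Window q t) (sym (m<n⇒m%n≡m (≰⇒> q≰x+κ)))
                       (≤-trans t≤κ (m≤n+m κ x) , subst (_< q) (m+n+o≡m+o+n x t κ) (≰⇒> q≰x+t+κ))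

    pair-small : ∀ {s t} → s + t ≡ q → ∀ x κ → x < q → κ < q →
      multiplesIn 0 κ + multiplesIn s κ ≤ multiplesIn x κ + multiplesIn (x + t) κ + χ (window? q t ((x + κ) % q))
    pair-small {s} {t} s+t≡q x κ x<q κ<q with κ <? t
    ... | yes κ<t = ≤-trans (≤-reflexive (cong₂ _+_ (multiplesIn≡0 0 κ κ<q) (multiplesIn≡0 s κ s+κ<q))) z≤n
      where
      s+κ<q : s + κ < q
      s+κ<q = subst (s + κ <_) s+t≡q (+-monoʳ-< s κ<t)
    ... | no κ≮t = begin
      multiplesIn 0 κ + multiplesIn s κ   ≡⟨ cong (_+ multiplesIn s κ) (multiplesIn≡0 0 κ κ<q) ⟩
      multiplesIn s κ                     ≤⟨ multiplesIn≤1 s κ (<⇒≤ κ<q) ⟩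
      1                                   ≤⟨ pair-rhs≥1 x κ x<q (≮⇒≥ κ≮t) ⟩
      multiplesIn x κ + multiplesIn (x + t) κ + χ (window? q t ((x + κ) % q)) ∎
      where open ≤-Reasoning

  -- Increasing k by q adds 1 to each of the four counts, so it suffices to treat k < q,
  -- where the left-hand side is at most 1.
  multiplesIn-pair : ∀ {s t} → s + t ≡ q → ∀ x k →
    multiplesIn 0 k + multiplesIn s k ≤ multiplesIn x k + multiplesIn (x + t) k + χ (window? q t ((x + k) % q))
  multiplesIn-pair {s} {t} s+t≡q x k = begin
    M 0 k + M s k                                       ≡⟨ cong₂ _+_ (multiplesIn-/% 0 k) (multiplesIn-/% s k) ⟩
    (K + M 0 κ) + (K + M s κ)                           ≡⟨ +-interchange K _ K _ ⟩
    (K + K) + (M 0 κ + M s κ)                           ≤⟨ +-monoʳ-≤ (K + K) (pair-small s+t≡q ξ κ (m%n<n x q) (m%n<n k q)) ⟩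
    (K + K) + (M ξ κ + M (ξ + t) κ + χ (window? q t ρ))   ≡⟨ regroup K (M ξ κ) _ _ ⟩
    (K + M ξ κ) + (K + M (ξ + t) κ) + χ (window? q t ρ)   ≡⟨ cong₂ (λ a b → a + b + χ (window? q t ρ)) x-side x+t-side ⟨
    M x k + M (x + t) k + χ (window? q t ρ)               ≡⟨ cong (λ y → M x k + M (x + t) k + χ (window? q t y)) (%-distribˡ-+ x k q) ⟨
    M x k + M (x + t) k + χ (window? q t ((x + k) % q))   ∎
    where
    open ≤-Reasoning
    M = multiplesIn
    K = k / q
    κ = k % q
    ξ = x % q
    ρ = (ξ + κ) % q
    regroup : ∀ K a b e → (K + K) + (a + b + e) ≡ (K + a) + (K + b) + e
    regroup = solve-∀
    x-side : M x k ≡ K + M ξ κ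
    x-side = trans (multiplesIn-/% x k) (cong (K +_) (multiplesIn-% x κ))
    x+t-side : M (x + t) k ≡ K + M (ξ + t) κ
    x+t-side = trans (multiplesIn-/% (x + t) k) (cong (K +_) (multiplesIn-%+ x t κ))

-- p-adic valuations

data ExactPower (p a x : ℕ) : Set where
  exact : ∀ u → x ≡ p ^ a * u → ¬ p ∣ u → ExactPower p a x

powersDividing : ℕ → ℕ → ℕ → ℕ
powersDividing p B y = ∑[ i < B ] χ (p ^ suc i ∣? y)

module _ {p : ℕ} (1<p : 1 < p) where

  private instance
    p≢0 : NonZero p
    p≢0 = >-nonZero (<-trans z<s 1<p)

  ^-monoʳ-∣ : ∀ {i a} → i ≤ a → p ^ i ∣ p ^ a
  ^-monoʳ-∣ {i} {a} i≤a = divides (p ^ (a ∸ i)) (begin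
    p ^ a                ≡⟨ cong (p ^_) (sym (m+[n∸m]≡n i≤a)) ⟩
    p ^ (i + (a ∸ i))    ≡⟨ ^-distribˡ-+-* p i (a ∸ i) ⟩
    p ^ i * p ^ (a ∸ i)  ≡⟨ *-comm (p ^ i) _ ⟩
    p ^ (a ∸ i) * p ^ i  ∎)
    where open ≡-Reasoning

  exactPower-∣ : ∀ {a x i} → ExactPower p a x → i ≤ a → p ^ i ∣ x
  exactPower-∣ (exact u refl _) i≤a = ∣-trans (^-monoʳ-∣ i≤a) (m∣m*n u)

  exactPower-∣⇒≤ : ∀ {a x i} → ExactPower p a x → p ^ i ∣ x → i ≤ a
  exactPower-∣⇒≤ {a} {i = i} (exact u refl p∤u) p^i∣x with i ≤? a
  ... | yes i≤a = i≤a
  ... | no  i≰a = ⊥-elim (p∤u (*-cancelˡ-∣ (p ^ a) {{m^n≢0 p a}} p^a*p∣p^a*u))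
    where
    p^a*p∣p^a*u : p ^ a * p ∣ p ^ a * u
    p^a*p∣p^a*u = subst (_∣ p ^ a * u) (*-comm p (p ^ a))
                        (∣-trans (^-monoʳ-∣ (≰⇒> i≰a)) p^i∣x)

  exactPower-unique : ∀ {a b x} → ExactPower p a x → ExactPower p b x → a ≡ b
  exactPower-unique {a} {b} ea eb = ≤-antisym (exactPower-∣⇒≤ eb (exactPower-∣ {a} ea ≤-refl))
                                              (exactPower-∣⇒≤ ea (exactPower-∣ {b} eb ≤-refl))

  vAux-exact : ∀ f x → 1 ≤ x → x ≤ f → ExactPower p (vAux f p x) x
  vAux-exact (suc f) (suc x) _ x<1+f with p ∣? suc x
  ... | no p∤1+x = exact (suc x) (sym (*-identityˡ (suc x))) p∤1+x
  ... | yes (divides q 1+x≡q*p) with vAux-exact f q 1≤q q≤f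
    where
    1≤q : 1 ≤ q
    1≤q = n≢0⇒n>0 λ { refl → 1+n≢0 1+x≡q*p }
    q≤f : q ≤ f
    q≤f = ≤-trans (≤-pred (subst (q <_) (sym 1+x≡q*p) (m<m*n q p {{>-nonZero 1≤q}} 1<p)))
                  (≤-pred x<1+f)
  ...   | exact u q≡p^v*u p∤u = exact u 1+x≡ p∤u
    where
    open ≡-Reasoning
    1+x≡ : suc x ≡ p * p ^ vAux f p q * u
    1+x≡ = begin
      suc x                        ≡⟨ 1+x≡q*p ⟩
      q * p                        ≡⟨ cong (_* p) q≡p^v*u ⟩
      p ^ vAux f p q * u * p       ≡⟨ *-comm _ p ⟩
      p * (p ^ vAux f p q * u)     ≡⟨ *-assoc p _ u ⟨
      p * p ^ vAux f p q * u       ∎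

  v-exact : ∀ {x} → 1 ≤ x → ExactPower p (v p x) x
  v-exact {x} 1≤x = vAux-exact x x 1≤x ≤-refl

  v-unique : ∀ {a x} → 1 ≤ x → ExactPower p a x → v p x ≡ a
  v-unique 1≤x = exactPower-unique (v-exact 1≤x)

  v≤ : ∀ x → v p x ≤ x
  v≤ x = vAux≤ x x
    where
    vAux≤ : ∀ f x → vAux f p x ≤ f
    vAux≤ zero    x       = z≤n
    vAux≤ (suc f) zero    = z≤n
    vAux≤ (suc f) (suc x) with p ∣? suc x
    ... | yes (divides q _) = s≤s (vAux≤ f q)
    ... | no _              = z≤n

  powersDividing≡⊓ : ∀ {a y} B → ExactPower p a y → powersDividing p B y ≡ B ⊓ a
  powersDividing≡⊓ {a} B ea =
    trans (∑-cong _ _ B (λ _ → χ-cong _ _ (exactPower-∣⇒≤ ea) (exactPower-∣ {a} ea))) (∑-≤?≡⊓ B)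
    where
    ∑-≤?≡⊓ : ∀ B → ∑[ i < B ] χ (suc i ≤? a) ≡ B ⊓ a
    ∑-≤?≡⊓ zero = refl
    ∑-≤?≡⊓ (suc B) with suc B ≤? a | ∑-≤?≡⊓ B
    ... | yes B<a | ih = begin
      ∑[ i < B ] χ (suc i ≤? a) + 1  ≡⟨ cong (_+ 1) (trans ih (m≤n⇒m⊓n≡m (<⇒≤ B<a))) ⟩
      B + 1                          ≡⟨ +-comm B 1 ⟩
      suc B                          ≡⟨ m≤n⇒m⊓n≡m B<a ⟨
      suc B ⊓ a                      ∎
      where open ≡-Reasoning
    ... | no  B≮a | ih = begin
      ∑[ i < B ] χ (suc i ≤? a) + 0  ≡⟨ +-identityʳ _ ⟩
      ∑[ i < B ] χ (suc i ≤? a)      ≡⟨ trans ih (m≥n⇒m⊓n≡n a≤B) ⟩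
      a                              ≡⟨ m≥n⇒m⊓n≡n (m≤n⇒m≤1+n a≤B) ⟨
      suc B ⊓ a                      ∎
      where
      open ≡-Reasoning
      a≤B : a ≤ B
      a≤B = ≤-pred (≰⇒> B≮a)

  powersDividing≡v : ∀ {y} B → 1 ≤ y → v p y ≤ B → powersDividing p B y ≡ v p y
  powersDividing≡v B 1≤y vy≤B = trans (powersDividing≡⊓ B (v-exact 1≤y)) (m≥n⇒m⊓n≡n vy≤B)

  powersDividing≤v : ∀ {y} B → 1 ≤ y → powersDividing p B y ≤ v p y
  powersDividing≤v {y} B 1≤y =
    subst (_≤ v p y) (sym (powersDividing≡⊓ B (v-exact 1≤y))) (m⊓n≤n B (v p y))

module _ {p : ℕ} (p-prime : Prime p) where

  private
    1<p : 1 < p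
    1<p = nonTrivial⇒n>1 p {{prime⇒nonTrivial p-prime}}

    p∤1 : ¬ p ∣ 1
    p∤1 p∣1 = <⇒≢ 1<p (sym (∣1⇒≡1 p∣1))

  exactPower-* : ∀ {a b x y} → ExactPower p a x → ExactPower p b y →
                 ExactPower p (a + b) (x * y)
  exactPower-* {a} {b} (exact u refl p∤u) (exact w refl p∤w) = exact (u * w) x*y≡ p∤u*w
    where
    x*y≡ : p ^ a * u * (p ^ b * w) ≡ p ^ (a + b) * (u * w)
    x*y≡ = trans (*-interchange (p ^ a) u (p ^ b) w)
                 (cong (_* (u * w)) (sym (^-distribˡ-+-* p a b)))
    p∤u*w : ¬ p ∣ u * w
    p∤u*w p∣u*w with euclidsLemma u w p-prime p∣u*w
    ... | inj₁ p∣u = p∤u p∣u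
    ... | inj₂ p∣w = p∤w p∣w

  v-* : ∀ {x y} → 1 ≤ x → 1 ≤ y → v p (x * y) ≡ v p x + v p y
  v-* 1≤x 1≤y = v-unique 1<p (*-mono-≤ 1≤x 1≤y)
                         (exactPower-* (v-exact 1<p 1≤x) (v-exact 1<p 1≤y))

  v-∏ : ∀ f k → (∀ {j} → j < k → 1 ≤ f j) → v p (prodℕ f k) ≡ ∑[ j < k ] v p (f j)
  v-∏ f zero    _   = v-unique 1<p ≤-refl (exact 1 refl p∤1)
  v-∏ f (suc k) pos = trans (v-* (prodℕ-pos f k (pos ∘ m<n⇒m<1+n)) (pos ≤-refl))
                            (cong (_+ v p (f k)) (v-∏ f k (pos ∘ m<n⇒m<1+n)))

  v[p]≡1 : v p p ≡ 1
  v[p]≡1 = v-unique 1<p (<⇒≤ 1<p) (exact 1 (sym (trans (*-identityʳ _) (*-identityʳ p))) p∤1)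

  coprime-^ : ∀ {u} → ¬ p ∣ u → ∀ N → Coprime u (p ^ N)
  coprime-^ p∤u zero    (_ , d∣1)       = ∣1⇒≡1 d∣1
  coprime-^ p∤u (suc N) (d∣u , d∣p*p^N) = coprime-^ p∤u N (d∣u , coprime-divisor d⊥p d∣p*p^N)
    where
    d⊥p : Coprime _ p
    d⊥p (e∣d , e∣p) with prime⇒irreducible p-prime e∣p
    ... | inj₁ e≡1 = e≡1
    ... | inj₂ refl = ⊥-elim (p∤u (∣-trans e∣d d∣u))

  ∣p*⇒∣ : ∀ {d x} → 1 ≤ d → 1 ≤ x → d ∣ p * x → v p d ≤ v p x → d ∣ x
  ∣p*⇒∣ {d} {x} 1≤d 1≤x d∣p*x vd≤vx with v-exact 1<p 1≤d | v-exact 1<p 1≤x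
  ... | exact u d≡ p∤u | exact w x≡ _ =
    subst₂ _∣_ (sym d≡) (sym x≡) (*-pres-∣ (^-monoʳ-∣ 1<p vd≤vx) u∣w)
    where
    p*x≡ : p * x ≡ p ^ suc (v p x) * w
    p*x≡ = trans (cong (p *_) x≡) (sym (*-assoc p _ w))
    u∣w : u ∣ w
    u∣w = coprime-divisor (coprime-^ p∤u (suc (v p x)))
            (subst (u ∣_) p*x≡ (∣-trans (subst (u ∣_) (sym d≡) (n∣m*n (p ^ v p d))) d∣p*x))

module _ {p : ℕ} (p-prime : Prime p) (f g : ℕ → ℕ) {k : ℕ}
         (f-pos : ∀ {j} → j < k → 1 ≤ f j) (g-pos : ∀ {j} → j < k → 1 ≤ g j) where

  private
    1<p : 1 < p
    1<p = nonTrivial⇒n>1 p {{prime⇒nonTrivial p-prime}}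

    ∑countDivisible≡ : ∀ B →
      ∑[ i < B ] (countDivisible (p ^ suc i) f k + countDivisible (p ^ suc i) g k) ≡
      ∑[ j < k ] (powersDividing p B (f j) + powersDividing p B (g j))
    ∑countDivisible≡ B = begin
      ∑[ i < B ] (countDivisible (p ^ suc i) f k + countDivisible (p ^ suc i) g k)
        ≡⟨ ∑-cong _ _ B (λ {i} _ → ∑-distrib-+ (λ j → χ (p ^ suc i ∣? f j)) (λ j → χ (p ^ suc i ∣? g j)) k) ⟨
      ∑[ i < B ] ∑[ j < k ] (χ (p ^ suc i ∣? f j) + χ (p ^ suc i ∣? g j))
        ≡⟨ ∑-comm (λ j i → χ (p ^ suc i ∣? f j) + χ (p ^ suc i ∣? g j)) k B ⟨
      ∑[ j < k ] ∑[ i < B ] (χ (p ^ suc i ∣? f j) + χ (p ^ suc i ∣? g j))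
        ≡⟨ ∑-cong _ _ k (λ {j} _ → ∑-distrib-+ (λ i → χ (p ^ suc i ∣? f j)) (λ i → χ (p ^ suc i ∣? g j)) B) ⟩
      ∑[ j < k ] (powersDividing p B (f j) + powersDividing p B (g j)) ∎
      where open ≡-Reasoning

  v-∏* : v p (prodℕ (λ j → f j * g j) k) ≡ ∑[ j < k ] (v p (f j) + v p (g j))
  v-∏* = trans (v-∏ p-prime _ k (λ j<k → *-mono-≤ (f-pos j<k) (g-pos j<k)))
               (∑-cong _ _ k (λ j<k → v-* p-prime (f-pos j<k) (g-pos j<k)))

  v-∏*≡∑countDivisible : ∀ B → (∀ {j} → j < k → v p (f j) ≤ B) → (∀ {j} → j < k → v p (g j) ≤ B) →
    v p (prodℕ (λ j → f j * g j) k) ≡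
    ∑[ i < B ] (countDivisible (p ^ suc i) f k + countDivisible (p ^ suc i) g k)
  v-∏*≡∑countDivisible B vf≤B vg≤B = trans v-∏* (trans (∑-cong _ _ k (λ j<k →
    cong₂ _+_ (sym (powersDividing≡v 1<p B (f-pos j<k) (vf≤B j<k)))
              (sym (powersDividing≡v 1<p B (g-pos j<k) (vg≤B j<k))))) (sym (∑countDivisible≡ B)))

  ∑countDivisible≤v-∏* : ∀ B →
    ∑[ i < B ] (countDivisible (p ^ suc i) f k + countDivisible (p ^ suc i) g k) ≤
    v p (prodℕ (λ j → f j * g j) k)
  ∑countDivisible≤v-∏* B = begin
    ∑[ i < B ] (countDivisible (p ^ suc i) f k + countDivisible (p ^ suc i) g k) ≡⟨ ∑countDivisible≡ B ⟩
    ∑[ j < k ] (powersDividing p B (f j) + powersDividing p B (g j))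
      ≤⟨ ∑-mono-≤ _ _ k (λ j<k → +-mono-≤ (powersDividing≤v 1<p B (f-pos j<k)) (powersDividing≤v 1<p B (g-pos j<k))) ⟩
    ∑[ j < k ] (v p (f j) + v p (g j))                                           ≡⟨ v-∏* ⟨
    v p (prodℕ (λ j → f j * g j) k)                                               ∎
    where open ≤-Reasoning

-- Linear congruences  n y + m ≡ 0 (mod q)

coprime⇒∃root : ∀ {m n} q .{{_ : NonZero q}} → Coprime q n → ∃[ s ] q ∣ n * s + m
coprime⇒∃root {m} {n} (suc c) q⊥n with coprime-Bézout q⊥n
... | Bézout.+- x y 1+y*n≡x*q = y * m , divides (x * m) (begin
  n * (y * m) + m          ≡⟨ solve (n ∷ y ∷ m ∷ []) ⟩
  (1 + y * n) * m          ≡⟨ cong (_* m) 1+y*n≡x*q ⟩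
  x * suc c * m            ≡⟨ solve (x ∷ c ∷ m ∷ []) ⟩
  x * m * suc c            ∎)
  where open ≡-Reasoning
... | Bézout.-+ x y 1+x*q≡y*n = y * m * c , divides (m + x * m * c) (begin
  n * (y * m * c) + m                  ≡⟨ solve (n ∷ y ∷ m ∷ c ∷ []) ⟩
  y * n * (m * c) + m                  ≡⟨ cong (λ z → z * (m * c) + m) 1+x*q≡y*n ⟨
  (1 + x * suc c) * (m * c) + m        ≡⟨ solve (x ∷ c ∷ m ∷ []) ⟩
  (m + x * m * c) * suc c              ∎)
  where open ≡-Reasoning

∃root⇒∃root< : ∀ {m n} q .{{_ : NonZero q}} → ∃[ s ] q ∣ n * s + m → ∃[ s ] s < q × q ∣ n * s + m
∃root⇒∃root< {m} {n} q (s , q∣ns+m) =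
  s % q , m%n<n s q , ∣-shift (q ∣0) (∣n⇒∣m*n n (n∣m*n (s / q))) ns+m≡ q∣ns+m
  where
  regroup : ∀ n a b m → n * (a + b) + m + 0 ≡ n * a + m + n * b
  regroup = solve-∀
  ns+m≡ : n * s + m + 0 ≡ n * (s % q) + m + n * (s / q * q)
  ns+m≡ = trans (cong (λ z → n * z + m + 0) (m≡m%n+[m/n]*n s q)) (regroup n (s % q) (s / q * q) m)

∣-cancel-coprime : ∀ {q n x y c d} → Coprime q n → q ∣ c → q ∣ d → x + c ≡ n * y + d → q ∣ x ⇔ q ∣ y
∣-cancel-coprime {n = n} q⊥n q∣c q∣d eq =
  mk⇔ (coprime-divisor q⊥n ∘ ∣-shift q∣c q∣d eq) (∣-shift q∣d q∣c (sym eq) ∘ ∣n⇒∣m*n n)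

module _ {m n q s t : ℕ} (m≤n : m ≤ n) (q⊥n : Coprime q n) (s+t≡q : s + t ≡ q) (q∣ns+m : q ∣ n * s + m) where

  ∣n*+m⇔∣+t : ∀ y → q ∣ n * y + m ⇔ q ∣ y + t
  ∣n*+m⇔∣+t y = ∣-cancel-coprime q⊥n (∣n⇒∣m*n n ∣-refl) q∣ns+m (begin
    n * y + m + n * q               ≡⟨ cong (λ z → n * y + m + n * z) s+t≡q ⟨
    n * y + m + n * (s + t)         ≡⟨ solve (n ∷ y ∷ m ∷ s ∷ t ∷ []) ⟩
    n * (y + t) + (n * s + m)       ∎)
    where open ≡-Reasoning

  ∣n∸m+n*⇔∣1+s+ : ∀ j → q ∣ n ∸ m + n * j ⇔ q ∣ suc (s + j)
  ∣n∸m+n*⇔∣1+s+ j = ∣-cancel-coprime q⊥n q∣ns+m (q ∣0) (begin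
    n ∸ m + n * j + (n * s + m)     ≡⟨ regroup (n ∸ m) n j s m ⟩
    (n ∸ m + m) + n * (s + j)       ≡⟨ cong (_+ n * (s + j)) (m∸n+n≡m m≤n) ⟩
    n + n * (s + j)                 ≡⟨ *-suc n (s + j) ⟨
    n * suc (s + j)                 ≡⟨ +-identityʳ _ ⟨
    n * suc (s + j) + 0             ∎)
    where
    open ≡-Reasoning
    regroup : ∀ a n j s m → a + n * j + (n * s + m) ≡ (a + m) + n * (s + j)
    regroup = solve-∀

  ∣n*t∸m : 1 ≤ t → q ∣ n * t ∸ m
  ∣n*t∸m 1≤t = ∣m+n∣m⇒∣n (subst (q ∣_) (sym ns+m+[nt∸m]≡nq) (∣n⇒∣m*n n ∣-refl)) q∣ns+m
    where
    open ≡-Reasoning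
    ns+m+[nt∸m]≡nq : n * s + m + (n * t ∸ m) ≡ n * q
    ns+m+[nt∸m]≡nq = begin
      n * s + m + (n * t ∸ m)       ≡⟨ +-assoc (n * s) m _ ⟩
      n * s + (m + (n * t ∸ m))     ≡⟨ cong (n * s +_) (m+[n∸m]≡n (≤-trans m≤n (m≤m*n n t {{>-nonZero 1≤t}}))) ⟩
      n * s + n * t                 ≡⟨ *-distribˡ-+ n s t ⟨
      n * (s + t)                   ≡⟨ cong (n *_) s+t≡q ⟩
      n * q                         ∎

-- Factors of the coefficients divisible by q

-- t plays the role of (l q + m) / n in the statement; t < q is implied by the window but bounds the search.
Good : ℕ → ℕ → ℕ → ℕ → Set
Good m n q ρ = ∃[ t ] t < q × (1 ≤ t × q ∣ n * t ∸ m × Window q t ρ)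

good? : ∀ m n q ρ → Dec (Good m n q ρ)
good? m n q ρ = anyUpTo? (λ t → 1 ≤? t ×-dec q ∣? n * t ∸ m ×-dec window? q t ρ) q

module _ {m n : ℕ} (m<n : m < n) {r k : ℕ} (k≤r : k ≤ r) (q : ℕ) .{{_ : NonZero q}} where

  private
    m≤n : m ≤ n
    m≤n = <⇒≤ m<n

  countDivisible-coprime : Coprime q n →
    countDivisible q (λ j → n ∸ m + n * j) k + countDivisible q suc k ≤
    countDivisible q (r ∸_) k + countDivisible q (λ j → n * (r ∸ j) + m) k + χ (good? m n q (r % q))
  countDivisible-coprime q⊥n with ∃root⇒∃root< {m} {n} q (coprime⇒∃root q q⊥n)
  ... | s , s<q , q∣ns+m = begin
    cD den + cD suc                            ≡⟨ +-comm (cD den) (cD suc) ⟩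
    M 0 k + cD den                             ≡⟨ cong (M 0 k +_) den≡ ⟩
    M 0 k + M s k                              ≤⟨ multiplesIn-pair q s+t≡q (r ∸ k) k ⟩
    numCount + χ (window? q t ((r ∸ k + k) % q)) ≡⟨ cong (λ z → numCount + χ (window? q t (z % q))) (m∸n+n≡m k≤r) ⟩
    numCount + χ (window? q t (r % q))         ≤⟨ +-monoʳ-≤ numCount (χ-mono (window? q t _) (good? m n q _) window⇒good) ⟩
    numCount + χ (good? m n q (r % q))         ≡⟨ cong (_+ χ (good? m n q (r % q))) numCount≡ ⟨
    cD (r ∸_) + cD num + χ (good? m n q (r % q)) ∎
    where
    open ≤-Reasoning
    den num : ℕ → ℕ
    den j = n ∸ m + n * j
    num j = n * (r ∸ j) + m
    cD = λ f → countDivisible q f k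
    M = multiplesIn q
    t = q ∸ s
    numCount = M (r ∸ k) k + M (r ∸ k + t) k
    s+t≡q : s + t ≡ q
    s+t≡q = m+[n∸m]≡n (<⇒≤ s<q)
    window⇒good : Window q t (r % q) → Good m n q (r % q)
    window⇒good w@(_ , ρ+t<q) =
      t , ≤-trans (s≤s (m≤n+m t _)) ρ+t<q , 1≤t , ∣n*t∸m m≤n q⊥n s+t≡q q∣ns+m 1≤t , w
      where
      1≤t = m<n⇒0<n∸m s<q
    den≡ : cD den ≡ M s k
    den≡ = countDivisible-cong q _ _ k (λ {j} _ → ∣n∸m+n*⇔∣1+s+ m≤n q⊥n s+t≡q q∣ns+m j)
    num≡ : cD num ≡ M (r ∸ k + t) k
    num≡ = trans (countDivisible-reverse q (λ y → n * y + m) k≤r) (countDivisible-cong q _ _ k λ {j} _ →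
      let e = cong suc (m+n+o≡m+o+n (r ∸ k) j t)
          y⇔ = ∣n*+m⇔∣+t m≤n q⊥n s+t≡q q∣ns+m (suc (r ∸ k + j))
      in mk⇔ (subst (q ∣_) e ∘ Equivalence.to y⇔) (Equivalence.from y⇔ ∘ subst (q ∣_) (sym e)))
    numCount≡ : cD (r ∸_) + cD num ≡ numCount
    numCount≡ = cong₂ _+_ (countDivisible-reverse q (λ y → y) k≤r) num≡

  countDivisible-∣ : ∀ {d} → d ∣ q → d ∣ n → ¬ d ∣ m →
    countDivisible q (λ j → n ∸ m + n * j) k + countDivisible q suc k ≤
    countDivisible q (r ∸_) k + countDivisible q (λ j → n * (r ∸ j) + m) k
  countDivisible-∣ {d} d∣q d∣n d∤m = begin
    countDivisible q (λ j → n ∸ m + n * j) k + multiplesIn q 0 k  ≡⟨ cong (_+ multiplesIn q 0 k) den≡0 ⟩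
    multiplesIn q 0 k                                             ≤⟨ multiplesIn-0≤ q (r ∸ k) k ⟩
    multiplesIn q (r ∸ k) k                                       ≡⟨ countDivisible-reverse q (λ y → y) k≤r ⟨
    countDivisible q (r ∸_) k                                     ≤⟨ m≤m+n _ _ ⟩
    countDivisible q (r ∸_) k + countDivisible q (λ j → n * (r ∸ j) + m) k ∎
    where
    open ≤-Reasoning
    den≡0 : countDivisible q (λ j → n ∸ m + n * j) k ≡ 0
    den≡0 = ∑≡0 _ k λ {j} _ → χ-no _ λ q∣den →
      d∤m (∣m+n∣m⇒∣n (subst (d ∣_) (n+nj≡ j) (∣m∣n⇒∣m+n d∣n (∣m⇒∣m*n j d∣n))) (∣-trans d∣q q∣den))
      where
      n+nj≡ : ∀ j → n + n * j ≡ n ∸ m + n * j + m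
      n+nj≡ j = trans (cong (_+ n * j) (sym (m∸n+n≡m m≤n))) (m+n+o≡m+o+n (n ∸ m) m (n * j))

∣prodℤ∣ : ∀ (f : ℕ → ℤ) k → ℤ.∣ prodℤ f k ∣ ≡ prodℕ (λ j → ℤ.∣ f j ∣) k
∣prodℤ∣ f zero    = refl
∣prodℤ∣ f (suc k) = trans (ℤ.abs-* (prodℤ f k) (f k)) (cong (_* ℤ.∣ f k ∣) (∣prodℤ∣ f k))

prodℤ≡0 : ∀ (f : ℕ → ℤ) {j} k → j < k → f j ≡ ℤ.+ 0 → prodℤ f k ≡ ℤ.+ 0
prodℤ≡0 f (suc k) j<1+k fj≡0 with m<1+n⇒m<n∨m≡n j<1+k
... | inj₁ j<k  = cong (ℤ._* f k) (prodℤ≡0 f k j<k fj≡0)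
... | inj₂ refl = trans (cong (prodℤ f k ℤ.*_) fj≡0) (ℤ.*-zeroʳ (prodℤ f k))

prodℕ-cong : ∀ (f g : ℕ → ℕ) k → (∀ {j} → j < k → f j ≡ g j) → prodℕ f k ≡ prodℕ g k
prodℕ-cong f g zero    _  = refl
prodℕ-cong f g (suc k) eq = cong₂ _*_ (prodℕ-cong f g k (eq ∘ m<n⇒m<1+n)) (eq ≤-refl)

module _ (m n r : ℕ) where

  open import Data.Integer using (+_)

  private
    factor : ℕ → ℤ
    factor j = (+ j ℤ.- + r) ℤ.* (+ (n * j) ℤ.- + (n * r) ℤ.- + m)

    ∣factor∣ : ∀ {j} → j ≤ r → ℤ.∣ factor j ∣ ≡ (r ∸ j) * (n * (r ∸ j) + m)
    ∣factor∣ {j} j≤r = trans (ℤ.abs-* (+ j ℤ.- + r) _) (cong₂ _*_ ∣j-r∣ ∣nj-nr-m∣)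
      where
      open ≡-Reasoning
      ∣j-r∣ : ℤ.∣ + j ℤ.- + r ∣ ≡ r ∸ j
      ∣j-r∣ = trans (cong ℤ.∣_∣ (ℤ.m-n≡m⊖n j r)) (ℤ.∣⊖∣-≤ j≤r)
      ∣nj-nr-m∣ : ℤ.∣ + (n * j) ℤ.- + (n * r) ℤ.- + m ∣ ≡ n * (r ∸ j) + m
      ∣nj-nr-m∣ = begin
        ℤ.∣ + (n * j) ℤ.- + (n * r) ℤ.- + m ∣
          ≡⟨ cong (λ z → ℤ.∣ z ℤ.- + m ∣) (trans (ℤ.m-n≡m⊖n (n * j) (n * r)) (ℤ.⊖-≤ (*-monoʳ-≤ n j≤r))) ⟩
        ℤ.∣ ℤ.- + (n * r ∸ n * j) ℤ.- + m ∣  ≡⟨ cong ℤ.∣_∣ (ℤ.neg-distrib-+ (+ (n * r ∸ n * j)) (+ m)) ⟨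
        ℤ.∣ ℤ.- + (n * r ∸ n * j + m) ∣      ≡⟨ ℤ.∣-i∣≡∣i∣ (+ (n * r ∸ n * j + m)) ⟩
        n * r ∸ n * j + m                    ≡⟨ cong (_+ m) (*-distribˡ-∸ n r j) ⟨
        n * (r ∸ j) + m                      ∎

  ∣coeffNum∣ : ∀ {k} → k ≤ r → ℤ.∣ coeffNum m n r k ∣ ≡ prodℕ (λ j → (r ∸ j) * (n * (r ∸ j) + m)) k
  ∣coeffNum∣ {k} k≤r = trans (∣prodℤ∣ factor k) (prodℕ-cong _ _ k (λ j<k → ∣factor∣ (≤-trans (<⇒≤ j<k) k≤r)))

  coeffNum≡0 : ∀ {k} → r < k → coeffNum m n r k ≡ + 0
  coeffNum≡0 {k} r<k = prodℤ≡0 factor k r<k (cong (ℤ._* (+ (n * r) ℤ.- + (n * r) ℤ.- + m)) (ℤ.+-inverseʳ (+ r)))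

  clears⇔ : ∀ D → ClearsDenominators m n r D ⇔ (∀ k → coeffDen m n r k ∣ D * ℤ.∣ coeffNum m n r k ∣)
  clears⇔ D = mk⇔ (λ clears k → subst (coeffDen m n r k ∣_) (ℤ.abs-* (+ D) _) (clears k))
                  (λ clears k → subst (coeffDen m n r k ∣_) (sym (ℤ.abs-* (+ D) _)) (clears k))

mod≡% : ∀ r q .{{_ : NonZero q}} → r mod q ≡ r % q
mod≡% r (suc q) = refl

module _ {m n l t Q : ℕ} (lQ+m≡nt : l * Q + m ≡ n * t) (1+t≤Q : suc t ≤ Q) where

  open import Data.Integer using (+_)

  private
    W = n * (Q ∸ suc t)

    W+nt+n≡nQ : W + n * t + n ≡ n * Q
    W+nt+n≡nQ = begin
      W + n * t + n           ≡⟨ +-assoc W (n * t) n ⟩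
      W + (n * t + n)         ≡⟨ cong (λ z → W + z) (trans (+-comm (n * t) n) (sym (*-suc n t))) ⟩
      W + n * suc t           ≡⟨ *-distribˡ-+ n (Q ∸ suc t) (suc t) ⟨
      n * (Q ∸ suc t + suc t) ≡⟨ cong (n *_) (m∸n+n≡m 1+t≤Q) ⟩
      n * Q                   ∎
      where open ≡-Reasoning

  [n-l]Q-m-n≡n[Q-t-1] : (+ n ℤ.- + l) ℤ.* + Q ℤ.- + m ℤ.- + n ≡ + (n * (Q ∸ suc t))
  [n-l]Q-m-n≡n[Q-t-1] = begin
    (+ n ℤ.- + l) ℤ.* + Q ℤ.- + m ℤ.- + n          ≡⟨ expand (+ n) (+ l) (+ Q) (+ m) ⟩
    + n ℤ.* + Q ℤ.- (+ l ℤ.* + Q ℤ.+ + m) ℤ.- + n  ≡⟨ cong₂ (λ a b → a ℤ.- (b ℤ.+ + m) ℤ.- + n) (ℤ.pos-* n Q) (ℤ.pos-* l Q) ⟨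
    + (n * Q) ℤ.- + (l * Q + m) ℤ.- + n            ≡⟨ cong₂ (λ a b → + a ℤ.- + b ℤ.- + n) (sym W+nt+n≡nQ) lQ+m≡nt ⟩
    + (W + n * t + n) ℤ.- + (n * t) ℤ.- + n        ≡⟨ cancel (+ W) (+ (n * t)) (+ n) ⟩
    + W                                            ∎
    where
    open ≡-Reasoning
    expand : ∀ N L Q M → (N ℤ.- L) ℤ.* Q ℤ.- M ℤ.- N ≡ N ℤ.* Q ℤ.- (L ℤ.* Q ℤ.+ M) ℤ.- N
    expand = ℤ-Solver.solve-∀
    cancel : ∀ W T N → W ℤ.+ T ℤ.+ N ℤ.- T ℤ.- N ≡ W
    cancel = ℤ-Solver.solve-∀

module _ {m n : ℕ} (m<n : m < n) (gcd≡1 : gcd m n ≡ 1) where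

  open import Data.Integer using (+_)

  Cond-intro : ∀ {l t ρ Q} → l * Q + m ≡ n * t → 1 ≤ t → t ≤ ρ → ρ + t < Q →
    (0 < l) × (gcd l n ≡ 1) × (n ∣ l * Q + m) × (+ (l * Q + m) ℤ.≤ + (n * ρ))
      × (+ (n * ρ) ℤ.≤ (+ n ℤ.- + l) ℤ.* + Q ℤ.- + m ℤ.- + n)
  Cond-intro {l} {t} {ρ} {Q} lQ+m≡nt 1≤t t≤ρ ρ+t<Q =
    0<l , coprime⇒gcd≡1 l⊥n , subst (n ∣_) (sym lQ+m≡nt) (m∣m*n t) ,
    ℤ.+≤+ (subst (_≤ n * ρ) (sym lQ+m≡nt) (*-monoʳ-≤ n t≤ρ)) ,
    subst (+ (n * ρ) ℤ.≤_) (sym ([n-l]Q-m-n≡n[Q-t-1] {m} {n} {l} lQ+m≡nt 1+t≤Q)) (ℤ.+≤+ (*-monoʳ-≤ n ρ≤Q∸1+t))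
    where
    0<l : 0 < l
    0<l = n≢0⇒n>0 λ { refl → <⇒≱ m<n (≤-trans (m≤m*n n t {{>-nonZero 1≤t}}) (≤-reflexive (sym lQ+m≡nt))) }
    l⊥n : Coprime l n
    l⊥n {d} (d∣l , d∣n) = ∣1⇒≡1 (subst (d ∣_) gcd≡1 (gcd-greatest d∣m d∣n))
      where
      d∣m : d ∣ m
      d∣m = ∣m+n∣m⇒∣n (subst (d ∣_) (sym lQ+m≡nt) (∣m⇒∣m*n t d∣n)) (∣m⇒∣m*n Q d∣l)
    1+t≤Q : suc t ≤ Q
    1+t≤Q = ≤-trans (s≤s (m≤n+m t ρ)) ρ+t<Q
    ρ≤Q∸1+t : ρ ≤ Q ∸ suc t
    ρ≤Q∸1+t = m+n≤o⇒m≤o∸n ρ (subst (_≤ Q) (sym (+-suc ρ t)) ρ+t<Q)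

  good⇒Cond : ∀ {r p i} .{{_ : NonZero (p ^ i)}} → Good m n (p ^ i) (r % p ^ i) → Cond m n r p i
  good⇒Cond {r} {p} {i} (t , _ , 1≤t , divides l nt∸m≡lQ , t≤ρ , ρ+t<Q) =
    l , Cond-intro lQ+m≡nt 1≤t (subst (t ≤_) ρ≡ t≤ρ) (subst (λ ρ → ρ + t < p ^ i) ρ≡ ρ+t<Q)
    where
    ρ≡ : r % p ^ i ≡ r mod (p ^ i)
    ρ≡ = sym (mod≡% r (p ^ i))
    lQ+m≡nt : l * p ^ i + m ≡ n * t
    lQ+m≡nt = trans (cong (_+ m) (sym nt∸m≡lQ)) (m∸n+n≡m (≤-trans (<⇒≤ m<n) (m≤m*n n t {{>-nonZero 1≤t}})))

Cond⇒p^i≤n*r : ∀ {m n r p i} → Cond m n r p i → p ^ i ≤ n * r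
Cond⇒p^i≤n*r {m} {n} {r} {p} {i} (l , 0<l , _ , _ , ℤ.+≤+ lQ+m≤nρ , _) = begin
  p ^ i                  ≤⟨ m≤n*m (p ^ i) l {{>-nonZero 0<l}} ⟩
  l * p ^ i              ≤⟨ m≤m+n _ m ⟩
  l * p ^ i + m          ≤⟨ lQ+m≤nρ ⟩
  n * (r mod (p ^ i))    ≤⟨ *-monoʳ-≤ n (mod≤ r (p ^ i)) ⟩
  n * r                  ∎
  where
  open ≤-Reasoning
  mod≤ : ∀ r q → r mod q ≤ r
  mod≤ r zero    = ≤-refl
  mod≤ r (suc q) = m%n≤m r (suc q)

length-filter-downFrom : ∀ {P : Pred ℕ _} (P? : Decidable P) B →
                         length (filter P? (downFrom B)) ≡ ∑[ i < B ] χ (P? i)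
length-filter-downFrom P? zero    = refl
length-filter-downFrom P? (suc B) with P? B
... | yes _ = trans (cong suc (length-filter-downFrom P? B)) (+-comm 1 _)
... | no _  = trans (length-filter-downFrom P? B) (sym (+-identityʳ _))

module _ {m n : ℕ} (m<n : m < n) (gcd≡1 : gcd m n ≡ 1) (r : ℕ) {p : ℕ} (p-prime : Prime p) where

  private
    p^≢0 : ∀ i → NonZero (p ^ i)
    p^≢0 i = m^n≢0 p i {{prime⇒nonZero p-prime}}

    1<p : 1 < p
    1<p = nonTrivial⇒n>1 p {{prime⇒nonTrivial p-prime}}

  residue : ℕ → ℕ
  residue i = _%_ r (p ^ suc i) {{p^≢0 (suc i)}}

  goodExponent? : ∀ i → Dec (Good m n (p ^ suc i) (residue i))
  goodExponent? i = good? m n (p ^ suc i) (residue i)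

  countGood : ℕ
  countGood = ∑[ i < n * r ] χ (goodExponent? i)

  private
    den num : ℕ → ℕ
    den j = n ∸ m + n * j
    num j = n * (r ∸ j) + m

    den-pos : ∀ j → 1 ≤ den j
    den-pos _ = ≤-trans (m<n⇒0<n∸m m<n) (m≤m+n _ _)

    r∸-pos : ∀ {j} → j < r → 1 ≤ r ∸ j
    r∸-pos = m<n⇒0<n∸m

    num-pos : ∀ {j} → j < r → 1 ≤ num j
    num-pos j<r = ≤-trans (*-mono-≤ (≤-trans (s≤s z≤n) m<n) (r∸-pos j<r)) (m≤m+n _ m)

  countDivisible-den≤num : ∀ {k} → k ≤ r → ∀ i → let q = p ^ suc i in
    countDivisible q den k + countDivisible q suc k ≤
    countDivisible q (r ∸_) k + countDivisible q num k + χ (goodExponent? i)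
  countDivisible-den≤num k≤r i with p ∣? n
  ... | yes p∣n =
    ≤-trans (countDivisible-∣ m<n k≤r (p ^ suc i) {{p^≢0 (suc i)}} (m∣m*n (p ^ i)) p∣n p∤m) (m≤m+n _ _)
    where
    p∤m : ¬ p ∣ m
    p∤m p∣m = <⇒≢ 1<p (sym (∣1⇒≡1 (subst (p ∣_) gcd≡1 (gcd-greatest p∣m p∣n))))
  ... | no p∤n =
    countDivisible-coprime m<n k≤r (p ^ suc i) {{p^≢0 (suc i)}} (Coprime.sym (coprime-^ p-prime p∤n (suc i)))

  numerator : ℕ → ℕ
  numerator k = prodℕ (λ j → (r ∸ j) * num j) k

  v-coeffDen≤ : ∀ {k} → k ≤ r → v p (coeffDen m n r k) ≤ v p (numerator k) + countGood
  v-coeffDen≤ {k} k≤r = begin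
    v p (coeffDen m n r k)
      ≡⟨ v-∏*≡∑countDivisible p-prime den suc (λ _ → den-pos _) (λ _ → s≤s z≤n) B vden≤B vsuc≤B ⟩
    ∑[ i < B ] (cD i den + cD i suc)
      ≤⟨ ∑-mono-≤ _ _ B (λ {i} _ → countDivisible-den≤num k≤r i) ⟩
    ∑[ i < B ] (cD i (r ∸_) + cD i num + χ (goodExponent? i))
      ≡⟨ ∑-distrib-+ (λ i → cD i (r ∸_) + cD i num) (χ ∘ goodExponent?) B ⟩
    ∑[ i < B ] (cD i (r ∸_) + cD i num) + countGood
      ≤⟨ +-monoˡ-≤ countGood (∑countDivisible≤v-∏* p-prime (r ∸_) num (r∸-pos ∘ j<r) (num-pos ∘ j<r) B) ⟩
    v p (numerator k) + countGood ∎
    where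
    open ≤-Reasoning
    B = n * r
    cD = λ i f → countDivisible (p ^ suc i) f k
    n≢0 : NonZero n
    n≢0 = >-nonZero (≤-trans (s≤s z≤n) m<n)
    j<r : ∀ {j} → j < k → j < r
    j<r j<k = ≤-trans j<k k≤r
    vden≤B : ∀ {j} → j < k → v p (den j) ≤ B
    vden≤B {j} j<k = begin
      v p (den j)        ≤⟨ v≤ 1<p (den j) ⟩
      n ∸ m + n * j      ≤⟨ +-monoˡ-≤ (n * j) (m∸n≤m n m) ⟩
      n + n * j          ≡⟨ *-suc n j ⟨
      n * suc j          ≤⟨ *-monoʳ-≤ n (j<r j<k) ⟩
      n * r              ∎
    vsuc≤B : ∀ {j} → j < k → v p (suc j) ≤ B
    vsuc≤B {j} j<k = ≤-trans (v≤ 1<p (suc j)) (≤-trans (j<r j<k) (m≤n*m r n {{n≢0}}))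

  clears-/p : ∀ {D} → 1 ≤ D → countGood ≤ v p D →
              ClearsDenominators m n r (D * p) → ClearsDenominators m n r D
  clears-/p {D} 1≤D countGood≤vD clears = Equivalence.from (clears⇔ m n r D) λ k →
    coeffDen∣ k (Equivalence.to (clears⇔ m n r (D * p)) clears k)
    where
    coeffDen∣ : ∀ k → coeffDen m n r k ∣ D * p * ℤ.∣ coeffNum m n r k ∣ →
                coeffDen m n r k ∣ D * ℤ.∣ coeffNum m n r k ∣
    coeffDen∣ k d∣Dp*N with k ≤? r
    ... | no k≰r rewrite coeffNum≡0 m n r (≰⇒> k≰r) | *-zeroʳ D = _ ∣0
    ... | yes k≤r =
      ∣p*⇒∣ p-prime den≥1 (*-mono-≤ 1≤D N≥1) (subst (coeffDen m n r k ∣_) Dp*N≡ d∣Dp*N) vden≤vDN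
      where
      N = ℤ.∣ coeffNum m n r k ∣
      N≡ : N ≡ numerator k
      N≡ = ∣coeffNum∣ m n r k≤r
      den≥1 : 1 ≤ coeffDen m n r k
      den≥1 = prodℕ-pos _ k λ _ → *-mono-≤ (den-pos _) (s≤s z≤n)
      N≥1 : 1 ≤ N
      N≥1 = subst (1 ≤_) (sym N≡) (prodℕ-pos _ k λ j<k →
              *-mono-≤ (r∸-pos (≤-trans j<k k≤r)) (num-pos (≤-trans j<k k≤r)))
      Dp*N≡ : D * p * N ≡ p * (D * N)
      Dp*N≡ = trans (cong (_* N) (*-comm D p)) (*-assoc p D N)
      vden≤vDN : v p (coeffDen m n r k) ≤ v p (D * N)
      vden≤vDN = begin
        v p (coeffDen m n r k)        ≤⟨ v-coeffDen≤ k≤r ⟩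
        v p (numerator k) + countGood ≤⟨ +-monoʳ-≤ _ countGood≤vD ⟩
        v p (numerator k) + v p D     ≡⟨ cong (λ x → v p x + v p D) N≡ ⟨
        v p N + v p D                 ≡⟨ +-comm (v p N) (v p D) ⟩
        v p D + v p N                 ≡⟨ v-* p-prime 1≤D N≥1 ⟨
        v p (D * N)                   ∎
        where open ≤-Reasoning

  v≤countGood : ∀ {D} → IsD m n r D → v p D ≤ countGood
  v≤countGood {D} (0<D , clears , minimal) with v p D ≤? countGood
  ... | yes bound = bound
  ... | no  ¬bound with exactPower-∣ 1<p {i = 1} (v-exact 1<p 0<D) (≤-trans (s≤s z≤n) (≰⇒> ¬bound))
  ...   | divides D′ D≡D′*p*1 =
    ⊥-elim (<⇒≱ D′<D (minimal D′ 0<D′ (clears-/p 0<D′ countGood≤vD′ (subst clearedBy D≡D′*p clears))))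
    where
    clearedBy = ClearsDenominators m n r
    D≡D′*p : D ≡ D′ * p
    D≡D′*p = trans D≡D′*p*1 (cong (D′ *_) (*-identityʳ p))
    0<D′ : 0 < D′
    0<D′ = n≢0⇒n>0 λ { refl → <⇒≢ 0<D (sym D≡D′*p) }
    D′<D : D′ < D
    D′<D = subst (D′ <_) (sym D≡D′*p) (m<m*n D′ p {{>-nonZero 0<D′}} 1<p)
    countGood≤vD′ : countGood ≤ v p D′
    countGood≤vD′ = ≤-pred (subst (countGood <_) vD≡1+vD′ (≰⇒> ¬bound))
      where
      vD≡1+vD′ : v p D ≡ suc (v p D′)
      vD≡1+vD′ = begin
        v p D              ≡⟨ cong (v p) D≡D′*p ⟩
        v p (D′ * p)       ≡⟨ v-* p-prime 0<D′ (<⇒≤ 1<p) ⟩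
        v p D′ + v p p     ≡⟨ cong (v p D′ +_) (v[p]≡1 p-prime) ⟩
        v p D′ + 1         ≡⟨ +-comm _ 1 ⟩
        suc (v p D′)       ∎
        where open ≡-Reasoning

  goodExponents : List ℕ
  goodExponents = map suc (filter goodExponent? (downFrom (n * r)))

  goodExponents-unique : Unique goodExponents
  goodExponents-unique = Unique.map⁺ suc-injective (Unique.filter⁺ goodExponent? (Unique.downFrom⁺ (n * r)))

  goodExponents-Cond : All (λ i → 0 < i × Cond m n r p i) goodExponents
  goodExponents-Cond = All-map⁺ (All.map (λ {i} good → z<s , good⇒Cond m<n gcd≡1 {r} {p} {suc i} {{p^≢0 (suc i)}} good)
                                         (all-filter goodExponent? (downFrom (n * r))))

  length-goodExponents : length goodExponents ≡ countGood
  length-goodExponents = trans (length-map suc (filter goodExponent? (downFrom (n * r))))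
                               (length-filter-downFrom goodExponent? (n * r))

proposition3p2 : (m n r p : ℕ) → 0 < m → m < n → 0 < r → gcd m n ≡ 1 → Prime p →
    (D : ℕ) → IsD m n r D →
    (∃ λ (is : List ℕ) → Unique is × All (λ i → (0 < i) × Cond m n r p i) is
    × (v p D ≤ length is))
    × (∀ i → 0 < i → Cond m n r p i → p ^ i ≤ n * r)
proposition3p2 m n r p _ m<n _ gcd≡1 p-prime D isD =
  ( goodExponents m<n gcd≡1 r p-prime
  , goodExponents-unique m<n gcd≡1 r p-prime
  , goodExponents-Cond m<n gcd≡1 r p-prime
  , subst (v p D ≤_) (sym (length-goodExponents m<n gcd≡1 r p-prime)) (v≤countGood m<n gcd≡1 r p-prime isD))
  , λ i _ → Cond⇒p^i≤n*r {m} {n} {r} {p} {i}
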